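{- Let $H$ be a digraph and let $u,v,w$ (with vertices $s(u),b(u),s(v),b(v),s(w),b(w)$) be a digraph asteroidal triple (DAT) in $H$. Then there exist, for each permutation $x,y,z$ of $u,v,w$, walks $P(x,s(x))$, $P(y,b(x))$, $P(z,b(x))$ as in the definition of a permutable triple, such that all the associated directed walks $P(x;y)$ and $P(x;z)$ in $H^+$ lie entirely inside one fixed strong component $C$ of $H^+$. In particular, the pairs $u,v$; $u,w$; $v,w$ and $s(u),b(u)$; $s(v),b(v)$; $s(w),b(w)$ are all invertible, and the vertices $(u,v),(v,u),(u,w),(w,u),(v,w),(w,v),(s(u),b(u)),(s(v),b(v)),(s(w),b(w))$ of $H^+$ all belong to $C$.
   Context: A digraph $H$ is a finite set $V(H)$ with a binary relation $E(H)$ (arcs). A walk in $H$ is a sequence $x_0,\dots,x_n$ of vertices together with, for each $i$, a designation of step $i$ as forward (requiring $x_ix_{i+1}\in E(H)$) or backward (requiring $x_{i+1}x_i\in E(H)$). Two walks $P=x_0,\dots,x_n$ and $Q=y_0,\dots,y_n$ are congruent if for every $i$ step $i$ of $P$ is forward iff step $i$ of $Q$ is forward. For congruent $P,Q$, $P$ avoids $Q$ if there is no $i$ with step $i$ forward and $x_iy_{i+1}\in E(H)$, and no $i$ with step $i$ backward and $y_{i+1}x_i\in E(H)$. $H^+$ is the digraph with vertex set all ordered pairs $(u,v)$ of vertices of $H$, with an arc from $(u,v)$ to $(u',v')$ if either $uu'\in E(H)$, $vv'\in E(H)$, $uv'\notin E(H)$, or $u'u\in E(H)$, $v'v\in E(H)$,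 $v'u\notin E(H)$. If $P=x_0,\dots,x_n$ and $Q=y_0,\dots,y_n$ are congruent and $P$ avoids $Q$, the sequence $(x_0,y_0),\dots,(x_n,y_n)$ is a directed walk in $H^+$. Two distinct vertices $u,v$ form an invertible pair if there exist congruent walks $P$ from $u$ to $v$ and $Q$ from $v$ to $u$ with $P$ avoiding $Q$, and congruent walks $P'$ from $v$ to $u$ and $Q'$ from $u$ to $v$ with $P'$ avoiding $Q'$. A permutable triple consists of three distinct vertices $u,v,w$ together with six vertices $s(u),b(u),s(v),b(v),s(w),b(w)$ such that for each $x\in\{u,v,w\}$, with $y,z$ the other two, there exist a walk $P(x,s(x))$ from $x$ to $s(x)$ and walks $P(y,b(x))$ from $y$ to $b(x)$ and $P(z,b(x))$ from $z$ to $b(x)$, both congruent to $P(x,s(x))$, such that $P(x,s(x))$ avoids both. The associated walks $P(x;y)$, $P(x;z)$ are the directed walks in $H^+$ from $(x,y)$, resp. $(x,z)$, to $(s(x),b(x))$ formed by pairing $P(x,s(x))$ coordinatewise with $P(y,b(x))$, resp. $P(z,b(x))$. A DAT is a permutable triple in which each pair $s(u),b(u)$; $s(v),b(v)$; $s(w),b(w)$ is invertible. -}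

module Defs where

open import Data.Nat using (ℕ)
open import Data.Fin using (Fin)
open import Data.Bool using (Bool; true)
open import Data.List using (List; []; _∷_)
open import Data.Product using (Σ; _×_; _,_)
open import Data.Unit using (⊤)
open import Relation.Nullary using (¬_)
open import Relation.Binary.PropositionalEquality using (_≡_; _≢_)
open import Relation.Binary.Construct.Closure.ReflexiveTransitive using (Star)

record Digraph : Set where
  field
    n   : ℕ
    adj : Fin n → Fin n → Bool

data Dir : Set where
  fw bw : Dir

module _ (H : Digraph) where
  open Digraph H

  V : Set
  V = Fin n

  Arc : V → V → Set
  Arc x y = adj x y ≡ true

  -- Walk ds x y : a walk from x to y whose i-th step has direction (ds ! i).
  -- Two walks are congruent iff they have the same direction list ds.
  data Walk : List Dir → V → V → Set where
    []    : ∀ {x} → Walk [] x x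
    fstep : ∀ {ds x y z} → Arc x y → Walk ds y z → Walk (fw ∷ ds) x z
    bstep : ∀ {ds x y z} → Arc y x → Walk ds y z → Walk (bw ∷ ds) x z

  Avoids : ∀ {ds x x' y y'} → Walk ds x x' → Walk ds y y' → Set
  Avoids [] [] = ⊤
  Avoids (fstep {x = x} _ p) (fstep {y = y₁} _ q) = ¬ Arc x y₁ × Avoids p q
  Avoids (bstep {x = x} _ p) (bstep {y = y₁} _ q) = ¬ Arc y₁ x × Avoids p q

  V⁺ : Set
  V⁺ = V × V

  Arc⁺ : V⁺ → V⁺ → Set
  Arc⁺ (u , v) (u' , v') =
    (Arc u u' × Arc v v' × ¬ Arc u v') Data.Sum.⊎ (Arc u' u × Arc v' v × ¬ Arc v' u)
    where import Data.Sum

  Reach⁺ : V⁺ → V⁺ → Set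
  Reach⁺ = Star Arc⁺

  InComp : V⁺ → V⁺ → Set
  InComp c p = Reach⁺ c p × Reach⁺ p c

  -- every vertex (x_i , y_i) of the H⁺-walk obtained by pairing P and Q
  -- satisfies the predicate C
  PairsIn : (V⁺ → Set) → ∀ {ds x x' y y'} → Walk ds x x' → Walk ds y y' → Set
  PairsIn C {x = x} {y = y} [] [] = C (x , y)
  PairsIn C {x = x} {y = y} (fstep _ p) (fstep _ q) = C (x , y) × PairsIn C p q
  PairsIn C {x = x} {y = y} (bstep _ p) (bstep _ q) = C (x , y) × PairsIn C p q

  Invertible : V → V → Set
  Invertible u v =
    u ≢ v
    × Σ (List Dir) (λ ds → Σ (Walk ds u v) λ P → Σ (Walk ds v u) λ Q → Avoids P Q)
    × Σ (List Dir) (λ ds → Σ (Walk ds v u) λ P' → Σ (Walk ds u v) λ Q' → Avoids P' Q')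

  -- Walks P(x,s(x)), P(y,b(x)), P(z,b(x)) as in the definition of a
  -- permutable triple, with the associated H⁺-walks P(x;y), P(x;z) lying
  -- in C.
  TripleWalksIn : (V⁺ → Set) → (x y z sx bx : V) → Set
  TripleWalksIn C x y z sx bx =
    Σ (List Dir) λ ds →
    Σ (Walk ds x sx) λ Px →
    Σ (Walk ds y bx) λ Py →
    Σ (Walk ds z bx) λ Pz →
      Avoids Px Py × Avoids Px Pz × PairsIn C Px Py × PairsIn C Px Pz

  TripleWalks : (x y z sx bx : V) → Set
  TripleWalks = TripleWalksIn (λ _ → ⊤)

  Distinct3 : V → V → V → Set
  Distinct3 u v w = u ≢ v × u ≢ w × v ≢ w

  PermutableTriple : (u v w su bu sv bv sw b₃ : V) → Set
  PermutableTriple u v w su bu sv bv sw b₃ =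
    Distinct3 u v w
    × TripleWalks u v w su bu
    × TripleWalks v u w sv bv
    × TripleWalks w u v sw b₃

  DAT : (u v w su bu sv bv sw b₃ : V) → Set
  DAT u v w su bu sv bv sw b₃ =
    PermutableTriple u v w su bu sv bv sw b₃
    × Invertible su bu × Invertible sv bv × Invertible sw b₃

module Submission where

-- Pairing two congruent walks P, Q with P avoiding Q is the same thing as
-- a directed walk in H⁺ (pairReach / unpairReach), and reversing the arcs
-- of H⁺ is the same as swapping coordinates (reverseSwap).  Hence for a
-- DAT with anchor x and other vertices y, z we have H⁺-walks
-- (x,y) → (s(x),b(x)) and (x,z) → (s(x),b(x)) (the legs P(x;y), P(x;z)),
-- and invertibility of s(x),b(x) gives (s(x),b(x)) → (b(x),s(x)).  Going
-- out along one leg, across the invertible pair and back along the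
-- swapped other leg gives (x,y) → (z,x) (detour), also for y = z.
-- These detours form two directed triangles
--   (u,v) → (w,u) → (v,w) → (u,v)   and   (u,w) → (v,u) → (w,v) → (u,w),
-- joined by (u,v) ⇄ (v,u), so all six pairs lie in the strong component C
-- of (u,v).  Each (s(x),b(x)) is in C too (landing), every vertex of an
-- H⁺-walk between two vertices of C is in C (pairsInComponent), and
-- mutual reachability of (x,y), (y,x) is exactly invertibility.

open import Defs
open import Data.Product using (Σ; _×_; _,_; proj₁; proj₂; swap)
open import Data.Sum using (inj₁; inj₂)
open import Data.List using (List; []; _∷_)
open import Relation.Binary.PropositionalEquality using (_≢_)
open import Relation.Binary.Construct.Closure.ReflexiveTransitive
  using (ε; _◅_; _◅◅_)

module _ (H : Digraph) where

  pairReach : ∀ {ds x x' y y'} (P : Walk H ds x x') (Q : Walk H ds y y') →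
    Avoids H P Q → Reach⁺ H (x , y) (x' , y')
  pairReach [] [] _ = ε
  pairReach (fstep a P) (fstep b Q) (n , av) = inj₁ (a , b , n) ◅ pairReach P Q av
  pairReach (bstep a P) (bstep b Q) (n , av) = inj₂ (a , b , n) ◅ pairReach P Q av

  unpairReach : ∀ {x x' y y'} → Reach⁺ H (x , y) (x' , y') →
    Σ (List Dir) λ ds → Σ (Walk H ds x x') λ P → Σ (Walk H ds y y') λ Q →
      Avoids H P Q
  unpairReach ε = [] , [] , [] , _
  unpairReach (inj₁ (a , b , n) ◅ r) with unpairReach r
  ... | ds , P , Q , av = fw ∷ ds , fstep a P , fstep b Q , n , av
  unpairReach (inj₂ (a , b , n) ◅ r) with unpairReach r
  ... | ds , P , Q , av = bw ∷ ds , bstep a P , bstep b Q , n , av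

  reverseSwapArc : ∀ {x y x' y'} → Arc⁺ H (x , y) (x' , y') →
    Arc⁺ H (y' , x') (y , x)
  reverseSwapArc (inj₁ (a , b , n)) = inj₂ (b , a , n)
  reverseSwapArc (inj₂ (a , b , n)) = inj₁ (b , a , n)

  reverseSwap : ∀ {x y x' y'} → Reach⁺ H (x , y) (x' , y') →
    Reach⁺ H (y' , x') (y , x)
  reverseSwap ε = ε
  reverseSwap (a ◅ r) = reverseSwap r ◅◅ (reverseSwapArc a ◅ ε)

  InComp-sym : ∀ {p q} → InComp H p q → InComp H q p
  InComp-sym = swap

  InComp-trans : ∀ {p q r} → InComp H p q → InComp H q r → InComp H p r
  InComp-trans (pq , qp) (qr , rq) = pq ◅◅ qr , rq ◅◅ qp

  triangle : ∀ {p q r} → Reach⁺ H p q → Reach⁺ H q r → Reach⁺ H r p →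
    InComp H p q × InComp H p r
  triangle pq qr rp = (pq , qr ◅◅ rp) , (pq ◅◅ qr , rp)

  invertibleFromComp : ∀ {x y} → x ≢ y → InComp H (x , y) (y , x) →
    Invertible H x y
  invertibleFromComp x≢y (xy→yx , yx→xy) =
    x≢y , unpairReach xy→yx , unpairReach yx→xy

  invertibleReach : ∀ {s b} → Invertible H s b → Reach⁺ H (s , b) (b , s)
  invertibleReach (_ , (_ , P , Q , av) , _) = pairReach P Q av

  detour : ∀ {p y z s b} → Reach⁺ H p (s , b) → Reach⁺ H (s , b) (b , s) →
    Reach⁺ H (z , y) (s , b) → Reach⁺ H p (y , z)
  detour out across back = out ◅◅ across ◅◅ reverseSwap back

  landing : ∀ {x y s b} → Reach⁺ H (x , y) (s , b) → Reach⁺ H (s , b) (b , s) →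
    Reach⁺ H (y , x) (x , y) → InComp H (x , y) (s , b)
  landing leg across yx→xy = leg , detour ε across leg ◅◅ yx→xy

  legs : ∀ {x y z s b} → TripleWalks H x y z s b →
    Reach⁺ H (x , y) (s , b) × Reach⁺ H (x , z) (s , b)
  legs (_ , Px , Py , Pz , avY , avZ , _) =
    pairReach Px Py avY , pairReach Px Pz avZ

  pairsInComponent : ∀ {c ds x x' y y'} (P : Walk H ds x x') (Q : Walk H ds y y') →
    Avoids H P Q → Reach⁺ H c (x , y) → Reach⁺ H (x' , y') c →
    PairsIn H (InComp H c) P Q
  pairsInComponent [] [] _ c→start end→c = c→start , end→c
  pairsInComponent P@(fstep a P') Q@(fstep b Q') av@(n , av') c→start end→c =
    (c→start , pairReach P Q av ◅◅ end→c) ,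
    pairsInComponent P' Q' av' (c→start ◅◅ (inj₁ (a , b , n) ◅ ε)) end→c
  pairsInComponent P@(bstep a P') Q@(bstep b Q') av@(n , av') c→start end→c =
    (c→start , pairReach P Q av ◅◅ end→c) ,
    pairsInComponent P' Q' av' (c→start ◅◅ (inj₂ (a , b , n) ◅ ε)) end→c

  tripleWalksInComponent : ∀ {c x y z s b} → TripleWalks H x y z s b →
    InComp H c (x , y) → InComp H c (x , z) → InComp H c (s , b) →
    TripleWalksIn H (InComp H c) x y z s b
  tripleWalksInComponent (ds , Px , Py , Pz , avY , avZ , _) cXY cXZ cSB =
    ds , Px , Py , Pz , avY , avZ ,
    pairsInComponent Px Py avY (proj₁ cXY) (proj₂ cSB) ,
    pairsInComponent Px Pz avZ (proj₁ cXZ) (proj₂ cSB)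

theorem3 : (H : Digraph) → (u v w su bu sv bv sw bw : V H) →
    DAT H u v w su bu sv bv sw bw →
    Σ (V⁺ H) λ c →
    TripleWalksIn H (InComp H c) u v w su bu
    × TripleWalksIn H (InComp H c) v u w sv bv
    × TripleWalksIn H (InComp H c) w u v sw bw
    × Invertible H u v × Invertible H u w × Invertible H v w
    × Invertible H su bu × Invertible H sv bv × Invertible H sw bw
    × InComp H c (u , v) × InComp H c (v , u)
    × InComp H c (u , w) × InComp H c (w , u)
    × InComp H c (v , w) × InComp H c (w , v)
    × InComp H c (su , bu) × InComp H c (sv , bv) × InComp H c (sw , bw)
theorem3 H u v w su bu sv bv sw b₃
  (((u≢v , u≢w , v≢w) , walksU , walksV , walksW) , invU , invV , invW) =
  (u , v) ,
  tripleWalksInComponent H walksU Cuv Cuw Csu ,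
  tripleWalksInComponent H walksV Cvu Cvw Csv ,
  tripleWalksInComponent H walksW Cwu Cwv Csw ,
  invertibleFromComp H u≢v Cvu ,
  invertibleFromComp H u≢w (InComp-trans H (InComp-sym H Cuw) Cwu) ,
  invertibleFromComp H v≢w (InComp-trans H (InComp-sym H Cvw) Cwv) ,
  invU , invV , invW ,
  Cuv , Cvu , Cuw , Cwu , Cvw , Cwv , Csu , Csv , Csw
  where
  uv⇝ : Reach⁺ H (u , v) (su , bu)
  uv⇝ = proj₁ (legs H walksU)
  uw⇝ : Reach⁺ H (u , w) (su , bu)
  uw⇝ = proj₂ (legs H walksU)
  vu⇝ : Reach⁺ H (v , u) (sv , bv)
  vu⇝ = proj₁ (legs H walksV)
  vw⇝ : Reach⁺ H (v , w) (sv , bv)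
  vw⇝ = proj₂ (legs H walksV)
  wu⇝ : Reach⁺ H (w , u) (sw , b₃)
  wu⇝ = proj₁ (legs H walksW)
  wv⇝ : Reach⁺ H (w , v) (sw , b₃)
  wv⇝ = proj₂ (legs H walksW)
  acrossU : Reach⁺ H (su , bu) (bu , su)
  acrossU = invertibleReach H invU
  acrossV : Reach⁺ H (sv , bv) (bv , sv)
  acrossV = invertibleReach H invV
  acrossW : Reach⁺ H (sw , b₃) (b₃ , sw)
  acrossW = invertibleReach H invW
  Cvu : InComp H (u , v) (v , u)
  Cvu = detour H uv⇝ acrossU uv⇝ , detour H vu⇝ acrossV vu⇝
  triangle₁ : InComp H (u , v) (w , u) × InComp H (u , v) (v , w)
  triangle₁ = triangle H (detour H uv⇝ acrossU uw⇝) (detour H wu⇝ acrossW wv⇝)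
                         (detour H vw⇝ acrossV vu⇝)
  triangle₂ : InComp H (u , w) (v , u) × InComp H (u , w) (w , v)
  triangle₂ = triangle H (detour H uw⇝ acrossU uv⇝) (detour H vu⇝ acrossV vw⇝)
                         (detour H wv⇝ acrossW wu⇝)
  Cuv : InComp H (u , v) (u , v)
  Cuv = ε , ε
  Cwu : InComp H (u , v) (w , u)
  Cwu = proj₁ triangle₁
  Cvw : InComp H (u , v) (v , w)
  Cvw = proj₂ triangle₁
  Cuw : InComp H (u , v) (u , w)
  Cuw = InComp-trans H Cvu (InComp-sym H (proj₁ triangle₂))
  Cwv : InComp H (u , v) (w , v)
  Cwv = InComp-trans H Cuw (proj₂ triangle₂)
  Csu : InComp H (u , v) (su , bu)
  Csu = landing H uv⇝ acrossU (proj₂ Cvu)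
  Csv : InComp H (u , v) (sv , bv)
  Csv = InComp-trans H Cvu (landing H vu⇝ acrossV (proj₁ Cvu))
  Csw : InComp H (u , v) (sw , b₃)
  Csw = InComp-trans H Cwu (landing H wu⇝ acrossW (detour H uw⇝ acrossU uw⇝))
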